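{- Let $N=(P,T,F)$ be a safe and sound WF-net and $G=\{T_{do},T_{redo},T_\tau\}$ such that $(N,G)$ is a loop pattern with places $p_{do},p_{redo}$. Let $\varphi_{do},\varphi_{redo}$ be POWL models with $\mathcal{L}(\mathrm{loopproject}(N,T_{do}))=\mathcal{L}(\varphi_{do})$ and $\mathcal{L}(\mathrm{loopproject}(N,T_{redo}))=\mathcal{L}(\varphi_{redo})$. Then $\mathcal{L}(\circlearrowleft(\varphi_{do},\varphi_{redo}))=\mathcal{L}(N)$.
   Context: A Petri net is a triple $N=(P,T,F)$ with finite disjoint sets $P$ (places) and $T$ (transitions) and flow relation $F\subseteq(P\times T)\cup(T\times P)$; each transition $t$ has a label $\ell(t)\in\mathcal{A}\cup\{\tau\}$, where $\mathcal{A}$ is a set of activities and $\tau\notin\mathcal{A}$ is silent. For a node $x$, ${}^\bullet x=\{y\mid (y,x)\in F\}$ and $x^\bullet=\{y\mid (x,y)\in F\}$. A marking is a multiset of places; $t$ is enabled if every place of ${}^\bullet t$ holds a token, and firing it removes one token from each place of ${}^\bullet t$ and adds one to each place of $t^\bullet$. $N$ is a WF-net if there are places $i_N$, $o_N$ with $\{p\mid {}^\bullet p=\emptyset\}=\{i_N\}$, $\{p\mid p^\bullet=\emptyset\}=\{o_N\}$, and every node lies on a directed path from $i_N$ to $o_N$. A WF-net is safe if no marking reachable from $[i_N]$ has a place with more than one token; it is sound if (i) every transition is enabled in some marking reachable from $[i_N]$, (ii) from every marking reachable from $[i_N]$ the marking $[o_N]$ is reachable, and (iii) $[o_N]$ is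 the only reachable marking with a token in $o_N$. The language $\mathcal{L}(N)$ of a WF-net is the set of label sequences ($\tau$-labels deleted) of firing sequences from $[i_N]$ to $[o_N]$. For $T'\subseteq T$, $P|_{T'}=\{p\in P\mid({}^\bullet p\cup p^\bullet)\cap T'\ne\emptyset\}$; for $P'\subseteq P$, $F|_{P',T'}=F\cap((P'\times T')\cup(T'\times P'))$. For places $p,p'$, $\mathrm{PTR}(p,p')$ is the set of transitions $t$ for which there exist $t_1,\dots,t_n\in T$ and $p_1=p,\dots,p_{n+1}=p'$ with $t\in\{t_1,\dots,t_n\}$ and, for each $k\le n$, $p_k\ne p'$, $(p_k,t_k)\in F$, $(t_k,p_{k+1})\in F$. Loop pattern: for a safe and sound WF-net $N$ and a partition $G=\{T_{do},T_{redo},T_\tau\}$ of $T$ of size 3, $(N,G)$ is a loop pattern iff there exist places $p_{do},p_{redo}$ with: (1) $T_\tau=\{t_{source},t_{sink}\}$, $t_{source}\ne t_{sink}$, both labelled $\tau$; (2) $i_N^\bullet=\{t_{source}\}$, ${}^\bullet o_N=\{t_{sink}\}$; (3) ${}^\bullet t_{source}=\{i_N\}$, $t_{source}^\bullet=\{p_{do}\}$; (4) ${}^\bullet t_{sink}=\{p_{redo}\}$, $t_{sink}^\bullet=\{o_N\}$; (5) $T_{do}=\mathrm{PTR}(p_{do},p_{redo})$, $T_{redo}=\mathrm{PTR}(p_{redo},p_{do})$; (6) ${}^\bullet p_{do}\cap T_{do}=\emptyset$, ${}^\bullet p_{redo}\cap T_{redo}=\emptyset$; (7) $p_{redo}^\bullet\cap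 T_{do}=\emptyset$, $p_{do}^\bullet\cap T_{redo}=\emptyset$. Loop projection: for $T'\in\{T_{do},T_{redo}\}$, with $(p_{start},p_{end})=(p_{do},p_{redo})$ if $T'=T_{do}$ and $(p_{redo},p_{do})$ if $T'=T_{redo}$, $\mathrm{loopproject}(N,T')=(P',T',F')$ with $P'=(P|_{T'}\setminus\{p_{do},p_{redo}\})\cup\{i_N,o_N\}$ and $F'=F|_{P',T'}\cup\{(i_N,t)\mid t\in T',(p_{start},t)\in F\}\cup\{(t,o_N)\mid t\in T',(t,p_{end})\in F\}$. POWL: every transition is a POWL model, and for POWL models $\varphi_1,\varphi_2$, $\circlearrowleft(\varphi_1,\varphi_2)$ is a POWL model (besides choice and partial order constructs). Semantics: $\mathcal{L}(t)=\{\langle\ell(t)\rangle\}$ if $\ell(t)\in\mathcal{A}$, $\{\langle\rangle\}$ if $\ell(t)=\tau$; $\mathcal{L}(\circlearrowleft(\varphi_1,\varphi_2))=L_1\cdot(L_2\cdot L_1)^*$ where $L_k=\mathcal{L}(\varphi_k)$ and $\cdot$ is element-wise concatenation of sets of sequences. -}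

module Defs where

open import Data.Bool using (Bool; true; false; if_then_else_; _∨_; _∧_)
open import Data.Nat using (ℕ; zero; suc; _+_; _∸_; _≤_)
open import Data.Fin using (Fin; _≟_)
open import Data.Maybe using (Maybe; just; nothing)
open import Data.List using (List; []; _∷_; _++_; map; mapMaybe; filter)
open import Data.List.Membership.Propositional using (_∈_)
open import Data.List.Relation.Unary.Any using (Any)
open import Data.List.Relation.Unary.All using (All)
open import Data.Product using (Σ; ∃; ∃-syntax; _×_; _,_; proj₁; proj₂)
open import Data.Sum using (_⊎_; inj₁; inj₂)
open import Relation.Binary.PropositionalEquality using (_≡_; _≢_; refl)
open import Relation.Nullary using (¬_)
open import Relation.Nullary.Decidable using (⌊_⌋)

-- Places P, transitions T (for the net N of the
-- theorem: P = Fin np, T = Fin nt, hence finite and disjoint).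
-- The flow relation F is given by two Boolean-valued characteristic
-- functions: pre p t ⇔ (p,t) ∈ F, post t p ⇔ (t,p) ∈ F.
-- Labels: just a ∈ 𝒜, nothing = τ (silent).

record PN (Act P T : Set) : Set where
  field
    pre   : P → T → Bool
    post  : T → P → Bool
    label : T → Maybe Act
open PN public

Marking : Set → Set
Marking P = P → ℕ

bit : Bool → ℕ
bit true  = 1
bit false = 0

single : ∀ {n} → Fin n → Marking (Fin n)
single q p = if ⌊ p ≟ q ⌋ then 1 else 0

_≗M_ : ∀ {P} → Marking P → Marking P → Set
M ≗M M' = ∀ p → M p ≡ M' p

module _ {Act P T : Set} (N : PN Act P T) where

  Enabled : Marking P → T → Set
  Enabled M t = ∀ p → pre N p t ≡ true → 1 ≤ M p

  fire : Marking P → T → Marking P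
  fire M t p = (M p ∸ bit (pre N p t)) + bit (post N t p)

  data FireSeq : Marking P → List T → Marking P → Set where
    done : ∀ {M} → FireSeq M [] M
    step : ∀ {M t ts M'} → Enabled M t → FireSeq (fire M t) ts M' →
           FireSeq M (t ∷ ts) M'

  Reachable : Marking P → Marking P → Set
  Reachable M M' = ∃[ ts ] FireSeq M ts M'

  visible : List T → List Act
  visible = mapMaybe (label N)

  Lang : Marking P → Marking P → List Act → Set
  Lang mi mf σ = ∃[ ts ] ∃[ M ] (FireSeq mi ts M × (M ≗M mf) × (visible ts ≡ σ))

  Node : Set
  Node = P ⊎ T

  Arc : Node → Node → Set
  Arc (inj₁ p) (inj₂ t) = pre N p t ≡ true
  Arc (inj₂ t) (inj₁ p) = post N t p ≡ true
  Arc _ _ = Data.Empty.⊥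
    where import Data.Empty

  data Path : Node → Node → Set where
    here : ∀ {x} → Path x x
    next : ∀ {x y z} → Arc x y → Path y z → Path x z

  data PTRWalk (p' : P) : P → List T → Set where
    last : ∀ {p t} → p ≢ p' → pre N p t ≡ true → post N t p' ≡ true →
           PTRWalk p' p (t ∷ [])
    cons : ∀ {p t q ts} → p ≢ p' → pre N p t ≡ true → post N t q ≡ true →
           PTRWalk p' q ts → PTRWalk p' p (t ∷ ts)

  PTR : P → P → T → Set
  PTR p p' t = ∃[ ts ] (PTRWalk p' p ts × t ∈ ts)

_⇔_ : Set → Set → Set
A ⇔ B = (A → B) × (B → A)

module _ {Act : Set} {np nt : ℕ} (N : PN Act (Fin np) (Fin nt)) where

  record IsWFNet (i o : Fin np) : Set where
    field
      sources  : ∀ p → (∀ t → post N t p ≡ false) ⇔ (p ≡ i)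
      sinks    : ∀ p → (∀ t → pre N p t ≡ false) ⇔ (p ≡ o)
      onPath   : ∀ (x : Node N) → Path N (inj₁ i) x × Path N x (inj₁ o)

  LangWF : Fin np → Fin np → List Act → Set
  LangWF i o = Lang N (single i) (single o)

  Safe : Fin np → Set
  Safe i = ∀ M → Reachable N (single i) M → ∀ p → M p ≤ 1

  record Sound (i o : Fin np) : Set where
    field
      quasiLive   : ∀ t → ∃[ M ] (Reachable N (single i) M × Enabled N M t)
      canComplete : ∀ M → Reachable N (single i) M →
                    ∃[ M' ] (Reachable N M M' × (M' ≗M single o))
      properEnd   : ∀ M → Reachable N (single i) M → 1 ≤ M o →
                    M ≗M single o

-- Partition G = {T_do, T_redo, T_τ} of T, given by a classifier.

data Class : Set where
  cdo credo ctau : Class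

module _ {Act : Set} {np nt : ℕ} (N : PN Act (Fin np) (Fin nt)) where

  -- (N , G) is a loop pattern with places p_do, p_redo, where
  -- G = {cls⁻¹ cdo, cls⁻¹ credo, cls⁻¹ ctau}.
  -- Safeness/soundness of N are separate hypotheses of the theorem.
  record LoopPattern (i o : Fin np) (cls : Fin nt → Class)
                     (pdo predo : Fin np) : Set where
    field
      -- G is a partition of size 3 (all three blocks nonempty)
      doNonEmpty   : ∃[ t ] (cls t ≡ cdo)
      redoNonEmpty : ∃[ t ] (cls t ≡ credo)
      tsource tsink : Fin nt
      tauBlock     : ∀ t → (cls t ≡ ctau) ⇔ (t ≡ tsource ⊎ t ≡ tsink)
      distinct     : tsource ≢ tsink
      sourceSilent : label N tsource ≡ nothing
      sinkSilent   : label N tsink ≡ nothing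
      iPost        : ∀ t → (pre N i t ≡ true) ⇔ (t ≡ tsource)
      oPre         : ∀ t → (post N t o ≡ true) ⇔ (t ≡ tsink)
      sourcePre    : ∀ p → (pre N p tsource ≡ true) ⇔ (p ≡ i)
      sourcePost   : ∀ p → (post N tsource p ≡ true) ⇔ (p ≡ pdo)
      sinkPre      : ∀ p → (pre N p tsink ≡ true) ⇔ (p ≡ predo)
      sinkPost     : ∀ p → (post N tsink p ≡ true) ⇔ (p ≡ o)
      doPTR        : ∀ t → (cls t ≡ cdo) ⇔ PTR N pdo predo t
      redoPTR      : ∀ t → (cls t ≡ credo) ⇔ PTR N predo pdo t
      preDoEmpty   : ∀ t → ¬ (post N t pdo ≡ true × cls t ≡ cdo)
      preRedoEmpty : ∀ t → ¬ (post N t predo ≡ true × cls t ≡ credo)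
      postRedoEmpty : ∀ t → ¬ (pre N predo t ≡ true × cls t ≡ cdo)
      postDoEmpty   : ∀ t → ¬ (pre N pdo t ≡ true × cls t ≡ credo)

  module Project (i o : Fin np) (cls : Fin nt → Class) (pdo predo : Fin np)
                 (c : Class) (pstart pend : Fin np) where

    T' : Set
    T' = Σ (Fin nt) (λ t → cls t ≡ c)

    InP' : Fin np → Set
    InP' p = ((∃[ t ] (cls t ≡ c × (pre N p t ≡ true ⊎ post N t p ≡ true)))
               × p ≢ pdo × p ≢ predo)
             ⊎ (p ≡ i ⊎ p ≡ o)

    P' : Set
    P' = Σ (Fin np) InP'

    net : PN Act P' T'
    net = record
      { pre   = λ p t → pre N (proj₁ p) (proj₁ t)
                        ∨ (⌊ proj₁ p ≟ i ⌋ ∧ pre N pstart (proj₁ t))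
      ; post  = λ t p → post N (proj₁ t) (proj₁ p)
                        ∨ (⌊ proj₁ p ≟ o ⌋ ∧ post N (proj₁ t) pend)
      ; label = λ t → label N (proj₁ t)
      }

    LangProj : List Act → Set
    LangProj = Lang net (λ p → single i (proj₁ p)) (λ p → single o (proj₁ p))

  LangLoopProjectDo : (i o : Fin np) (cls : Fin nt → Class) (pdo predo : Fin np) →
                      List Act → Set
  LangLoopProjectDo i o cls pdo predo = Project.LangProj i o cls pdo predo cdo pdo predo

  LangLoopProjectRedo : (i o : Fin np) (cls : Fin nt → Class) (pdo predo : Fin np) →
                        List Act → Set
  LangLoopProjectRedo i o cls pdo predo = Project.LangProj i o cls pdo predo credo predo pdo

data POWL (Act : Set) : Set where
  trans : Maybe Act → POWL Act
  loop  : POWL Act → POWL Act → POWL Act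
  xor   : (n : ℕ) → 2 ≤ n → (Fin n → POWL Act) → POWL Act
  po    : (n : ℕ) → 2 ≤ n → (Fin n → POWL Act) → (ord : Fin n → Fin n → Bool) →
          (∀ k → ord k k ≡ false) →
          (∀ j k l → ord j k ≡ true → ord k l ≡ true → ord j l ≡ true) →
          POWL Act

data LoopL {Act : Set} (L₁ L₂ : List Act → Set) : List Act → Set where
  once  : ∀ {σ} → L₁ σ → LoopL L₁ L₂ σ
  again : ∀ {σ τ ρ} → LoopL L₁ L₂ σ → L₂ τ → L₁ ρ → LoopL L₁ L₂ (σ ++ τ ++ ρ)

proj : ∀ {Act : Set} {n} → Fin n → List (Fin n × Act) → List Act
proj k w = map proj₂ (filter (λ x → proj₁ x ≟ k) w)

Precedes : ∀ {Act : Set} {n} → Fin n → Fin n → List (Fin n × Act) → Set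
Precedes j k w = ∀ xs ys → xs ++ ys ≡ w →
                 Any (λ x → proj₁ x ≡ k) xs → All (λ y → proj₁ y ≢ j) ys

LangP : ∀ {Act : Set} → POWL Act → List Act → Set
LangP (trans (just a)) σ = σ ≡ a ∷ []
LangP (trans nothing)  σ = σ ≡ []
LangP (loop φ₁ φ₂)     σ = LoopL (LangP φ₁) (LangP φ₂) σ
LangP (xor n _ φs)     σ = ∃[ k ] LangP (φs k) σ
LangP (po n _ φs ord _ _) σ =
  ∃[ w ] (map proj₂ w ≡ σ
          × (∀ k → LangP (φs k) (proj k w))
          × (∀ j k → ord j k ≡ true → Precedes j k w))

_≐_ : ∀ {Act : Set} → (List Act → Set) → (List Act → Set) → Set
L ≐ L' = ∀ σ → L σ ⇔ L' σ

{-# OPTIONS --safe #-}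

-- An accepting run of N starts with t_source, reaching [p_do]. Soundness forces every reachable
-- marking that marks p_do (resp. p_redo) to be exactly [p_do] (resp. [p_redo]), so the run splits,
-- at the moments p_redo and p_do become marked, into alternating do- and redo-phases and ends with
-- t_sink. During a phase every token was produced by a transition of that phase; with the PTR
-- characterisation (5) of T_do and T_redo and conditions (6) and (7) this shows that only
-- transitions of the phase can fire. Reading i_N as the start and o_N as the end place of the phase,
-- a phase is then exactly a run of the corresponding loop projection, and conversely.

module Submission where

open import Defs hiding (trans)
open import Data.Nat using (ℕ; _+_; _∸_; _≤_; _<_; z≤n; s≤s)
open import Data.Nat.Properties
  using ( _≤?_; n<1⇒n≡0; ≰⇒>; <-trans; ≤-trans; ≤-reflexive; m≤m+n; m∸n≤m; +-∸-comm; +-assoc; +-comm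
        ; +-identityʳ; +-cancelˡ-≡; m+[n∸m]≡n)
open import Data.Fin using (Fin; _≟_)
open import Data.Bool using (true; false)
open import Data.Bool.Properties using (¬-not; ∨-identityʳ)
open import Data.Maybe using (nothing)
open import Data.List using (List; []; _∷_; _++_; map; length)
open import Data.List.Properties using (mapMaybe-++; mapMaybe-map; length-++-≤ʳ; ++-assoc; ++-identityʳ)
open import Data.List.Membership.Propositional using (_∈_)
open import Data.List.Relation.Unary.Any using (here; there)
open import Data.Product using (∃-syntax; _×_; _,_; proj₁; proj₂)
open import Data.Sum using (_⊎_; inj₁; inj₂)
open import Relation.Binary.Definitions using (DecidableEquality)
open import Relation.Binary.PropositionalEquality
  using (_≡_; _≢_; refl; sym; trans; cong; subst; ≢-sym; module ≡-Reasoning)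
open import Relation.Nullary using (¬_; yes; no; contradiction)
open import Function using (_∘_)
open import Induction.WellFounded using (Acc; acc)
open import Data.Nat.Induction using (<-wellFounded)

_⊕_ : ∀ {P : Set} → Marking P → Marking P → Marking P
(A ⊕ E) p = A p + E p

module _ {n : ℕ} where

  single-self : (q : Fin n) → single q q ≡ 1
  single-self q with q ≟ q
  ... | yes _   = refl
  ... | no q≢q = contradiction refl q≢q

  single-other : {p q : Fin n} → p ≢ q → single q p ≡ 0
  single-other {p} {q} p≢q with p ≟ q
  ... | yes p≡q = contradiction p≡q p≢q
  ... | no _    = refl

  single-pos : {p q : Fin n} → 1 ≤ single q p → p ≡ q
  single-pos {p} {q} pos with p ≟ q
  ... | yes p≡q = p≡q
  single-pos () | no _

  single-injective : ∀ {M : Marking (Fin n)} {p q} → M ≗M single p → M ≗M single q → p ≡ q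
  single-injective {p = p} M≗p M≗q =
    single-pos (subst (1 ≤_) (trans (sym (M≗p p)) (M≗q p)) (≤-reflexive (sym (single-self p))))

  single⊕rest : ∀ {M : Marking (Fin n)} {p} → 1 ≤ M p → M ≗M (single p ⊕ λ q → M q ∸ single p q)
  single⊕rest {M} {p} pos q = sym (m+[n∸m]≡n single≤M)
    where
    single≤M : single p q ≤ M q
    single≤M with q ≟ p
    ... | yes refl = pos
    ... | no _     = z≤n

module _ {Act P T : Set} (N : PN Act P T) where

  fire-resp-≗ : ∀ {A B} t → A ≗M B → fire N A t ≗M fire N B t
  fire-resp-≗ t A≗B p = cong (λ m → (m ∸ bit (pre N p t)) + bit (post N t p)) (A≗B p)

  Enabled-resp-≗ : ∀ {A B t} → A ≗M B → Enabled N B t → Enabled N A t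
  Enabled-resp-≗ A≗B en p pre≡true = subst (1 ≤_) (sym (A≗B p)) (en p pre≡true)

  FireSeq-resp-≗ : ∀ {A A' ts B} → A' ≗M A → FireSeq N A ts B →
                   ∃[ B' ] (FireSeq N A' ts B' × B' ≗M B)
  FireSeq-resp-≗ A'≗A done = _ , done , A'≗A
  FireSeq-resp-≗ A'≗A (step {t = t} en fs) with FireSeq-resp-≗ (fire-resp-≗ t A'≗A) fs
  ... | B' , fs' , B'≗B = B' , step (Enabled-resp-≗ A'≗A en) fs' , B'≗B

  FireSeq-++ : ∀ {A ts B us C} → FireSeq N A ts B → FireSeq N B us C → FireSeq N A (ts ++ us) C
  FireSeq-++ done          gs = gs
  FireSeq-++ (step en fs) gs = step en (FireSeq-++ fs gs)

  Reachable-++ : ∀ {X A ts B} → Reachable N X A → FireSeq N A ts B → Reachable N X B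
  Reachable-++ (_ , fs) gs = _ , FireSeq-++ fs gs

  bit-pre≤ : ∀ {M t} p → Enabled N M t → bit (pre N p t) ≤ M p
  bit-pre≤ {t = t} p en with pre N p t in pre≡
  ... | true  = en p pre≡
  ... | false = z≤n

  fire-⊕ : ∀ {A t} E → Enabled N A t → fire N (A ⊕ E) t ≗M (fire N A t ⊕ E)
  fire-⊕ {A} {t} E en p = begin
    (A p + E p ∸ b) + c   ≡⟨ cong (_+ c) (+-∸-comm (E p) (bit-pre≤ p en)) ⟩
    (A p ∸ b + E p) + c   ≡⟨ +-assoc (A p ∸ b) (E p) c ⟩
    A p ∸ b + (E p + c)   ≡⟨ cong (A p ∸ b +_) (+-comm (E p) c) ⟩
    A p ∸ b + (c + E p)   ≡⟨ sym (+-assoc (A p ∸ b) c (E p)) ⟩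
    (A p ∸ b + c) + E p   ∎
    where
    open ≡-Reasoning
    b = bit (pre N p t)
    c = bit (post N t p)

  FireSeq-⊕ : ∀ {A A' ts B} E → A' ≗M (A ⊕ E) → FireSeq N A ts B →
              ∃[ B' ] (FireSeq N A' ts B' × B' ≗M (B ⊕ E))
  FireSeq-⊕ E A'≗ done = _ , done , A'≗
  FireSeq-⊕ {A} E A'≗ (step {t = t} en fs)
    with FireSeq-⊕ E (λ p → trans (fire-resp-≗ t A'≗ p) (fire-⊕ E en p)) fs
  ... | B' , fs' , B'≗ = B' , step (Enabled-resp-≗ A'≗ en⊕) fs' , B'≗
    where
    en⊕ : Enabled N (A ⊕ E) t
    en⊕ p pre≡true = ≤-trans (en p pre≡true) (m≤m+n (A p) (E p))

  fire-pos : ∀ {M t} p → 1 ≤ fire N M t p → post N t p ≡ true ⊎ 1 ≤ M p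
  fire-pos {M} {t} p pos with post N t p
  ... | true  = inj₁ refl
  ... | false = inj₂ (≤-trans (subst (1 ≤_) (+-identityʳ _) pos) (m∸n≤m (M p) (bit (pre N p t))))

  visible-++ : ∀ ts us → visible N (ts ++ us) ≡ visible N ts ++ visible N us
  visible-++ = mapMaybe-++ (label N)

  Lang-++ : ∀ {A B C σ τ} → Lang N A B σ → Lang N B C τ → Lang N A C (σ ++ τ)
  Lang-++ (ts , _ , fs , B'≗B , refl) (us , _ , gs , C'≗C , refl) with FireSeq-resp-≗ B'≗B gs
  ... | _ , gs' , C''≗C' = ts ++ us , _ , FireSeq-++ fs gs' , (λ p → trans (C''≗C' p) (C'≗C p)) ,
                           visible-++ ts us
  visible-silent : ∀ {t} ts → label N t ≡ nothing → visible N (t ∷ ts) ≡ visible N ts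
  visible-silent _ silent rewrite silent = refl

  Lang-silent : ∀ {A B t} → label N t ≡ nothing → Enabled N A t → fire N A t ≗M B → Lang N A B []
  Lang-silent silent en fire≗B = _ ∷ [] , _ , step en done , fire≗B , visible-silent [] silent

  has-input : ∀ {p t} → Path N (inj₁ p) (inj₂ t) → ∃[ q ] (pre N q t ≡ true)
  has-input {p} (next {y = inj₂ _} p→t here)              = p , p→t
  has-input     (next {y = inj₂ _} _ (next {y = inj₁ _} _ path)) = has-input path
  has-input     (next {y = inj₂ _} _ (next {y = inj₂ _} () _))
  has-input     (next {y = inj₁ _} () _)

  PTRWalk-head≢ : ∀ {a b ws} → PTRWalk N b a ws → a ≢ b
  PTRWalk-head≢ (last a≢b _ _)   = a≢b
  PTRWalk-head≢ (cons a≢b _ _ _) = a≢b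

  Reaches : P → P → Set
  Reaches y b = y ≡ b ⊎ ∃[ ws ] PTRWalk N b y ws

  data WalkAvoiding (b a : P) : P → Set where
    start : WalkAvoiding b a a
    snoc  : ∀ {x t y} → WalkAvoiding b a x → x ≢ b → pre N x t ≡ true → post N t y ≡ true →
            WalkAvoiding b a y

  private
    cons-avoiding : ∀ {a b t q x} → a ≢ b → pre N a t ≡ true → post N t q ≡ true →
                    WalkAvoiding b q x → WalkAvoiding b a x
    cons-avoiding a≢b pre≡ post≡ start                     = snoc start a≢b pre≡ post≡
    cons-avoiding a≢b pre≡ post≡ (snoc w x≢b pre≡' post≡') =
      snoc (cons-avoiding a≢b pre≡ post≡ w) x≢b pre≡' post≡'

    prepend : ∀ {a b x ws t} → WalkAvoiding b a x → PTRWalk N b x ws → t ∈ ws → PTR N a b t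
    prepend start               W t∈ = _ , W , t∈
    prepend (snoc w x≢b pre≡ post≡) W t∈ = prepend w (cons x≢b pre≡ post≡ W) (there t∈)

  PTR-split : ∀ {a b t} → PTR N a b t →
              ∃[ x ] ∃[ y ] (WalkAvoiding b a x × x ≢ b × pre N x t ≡ true × post N t y ≡ true
                             × Reaches y b)
  PTR-split (_ , W , t∈) = split W t∈
    where
    split : ∀ {a b ws t} → PTRWalk N b a ws → t ∈ ws →
            ∃[ x ] ∃[ y ] (WalkAvoiding b a x × x ≢ b × pre N x t ≡ true × post N t y ≡ true
                           × Reaches y b)
    split (last a≢b pre≡ post≡)   (here refl) = _ , _ , start , a≢b , pre≡ , post≡ , inj₁ refl
    split (cons a≢b pre≡ post≡ W) (here refl) = _ , _ , start , a≢b , pre≡ , post≡ , inj₂ (_ , W)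
    split (cons a≢b pre≡ post≡ W) (there t∈) with split W t∈
    ... | x , y , w , rest = x , y , cons-avoiding a≢b pre≡ post≡ w , rest

  PTR-join : ∀ {a b x t y} → WalkAvoiding b a x → x ≢ b → pre N x t ≡ true → post N t y ≡ true →
             Reaches y b → PTR N a b t
  PTR-join w x≢b pre≡ post≡ (inj₁ refl)   = prepend w (last x≢b pre≡ post≡) (here refl)
  PTR-join w x≢b pre≡ post≡ (inj₂ (_ , W)) = prepend w (cons x≢b pre≡ post≡ W) (here refl)

  module _ (_≟ₚ_ : DecidableEquality P) where

    Reaches-step : ∀ {y t q b} → pre N y t ≡ true → post N t q ≡ true → Reaches q b → Reaches y b
    Reaches-step {y} {b = b} pre≡ post≡ r with y ≟ₚ b
    ... | yes y≡b = inj₁ y≡b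
    ... | no y≢b with r
    ...   | inj₁ refl    = inj₂ (_ , last y≢b pre≡ post≡)
    ...   | inj₂ (_ , W) = inj₂ (_ , cons y≢b pre≡ post≡ W)

    Reaches-trans : ∀ {y a b} → Reaches y a → Reaches a b → Reaches y b
    Reaches-trans (inj₁ refl)    r = r
    Reaches-trans (inj₂ (_ , W)) r = walk W r
      where
      walk : ∀ {a y b ws} → PTRWalk N a y ws → Reaches a b → Reaches y b
      walk (last _ pre≡ post≡)   r = Reaches-step pre≡ post≡ r
      walk (cons _ pre≡ post≡ W) r = Reaches-step pre≡ post≡ (walk W r)

module _ {Act : Set} {np nt : ℕ} (N : PN Act (Fin np) (Fin nt)) where

  Enabled-single⇒pre : ∀ {M a t q} → M ≗M single a → pre N q t ≡ true → Enabled N M t →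
                       pre N a t ≡ true
  Enabled-single⇒pre {t = t} {q} M≗a pre-q en =
    subst (λ p → pre N p t ≡ true) (single-pos (subst (1 ≤_) (M≗a q) (en q pre-q))) pre-q

  single-input⇒Enabled : ∀ {a t} → (∀ p → pre N p t ≡ true → p ≡ a) → Enabled N (single a) t
  single-input⇒Enabled {a} pre⇒a p pre-p rewrite pre⇒a p pre-p = ≤-reflexive (sym (single-self a))

  fire-single : ∀ {a b t} → a ≢ b → (∀ p → (pre N p t ≡ true) ⇔ (p ≡ a)) →
                (∀ p → (post N t p ≡ true) ⇔ (p ≡ b)) → fire N (single a) t ≗M single b
  fire-single {a} {b} {t} a≢b pre⇔ post⇔ p with p ≟ a | p ≟ b
  ... | yes p≡a | yes p≡b = contradiction (trans (sym p≡a) p≡b) a≢b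
  ... | yes p≡a | no p≢b
    rewrite proj₂ (pre⇔ p) p≡a | ¬-not (p≢b ∘ proj₁ (post⇔ p)) = refl
  ... | no p≢a  | yes p≡b
    rewrite ¬-not (p≢a ∘ proj₁ (pre⇔ p)) | proj₂ (post⇔ p) p≡b = refl
  ... | no p≢a  | no p≢b
    rewrite ¬-not (p≢a ∘ proj₁ (pre⇔ p)) | ¬-not (p≢b ∘ proj₁ (post⇔ p)) = refl

  -- Tokens beside [p] would survive the completion of [p] to [o], contradicting proper completion.
  sound⇒single : ∀ {i o} → Sound N i o → ∀ {M p σ} → Reachable N (single i) M → 1 ≤ M p →
                 Lang N (single p) (single o) σ → M ≗M single p
  sound⇒single {i} {o} sound {M} {p} reach pos (_ , Y , fs , Y≗o , _)
    with FireSeq-⊕ N (λ q → M q ∸ single p q) (single⊕rest pos) fs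
  ... | Y' , fs' , Y'≗ = λ q →
    trans (single⊕rest pos q) (trans (cong (single p q +_) (rest≡0 q)) (+-identityʳ _))
    where
    open ≡-Reasoning

    Y'≗o : Y' ≗M single o
    Y'≗o = Sound.properEnd sound Y' (Reachable-++ N reach fs') (subst (1 ≤_) (sym Y'o≡) (s≤s z≤n))
      where
      Y'o≡ : Y' o ≡ 1 + (M o ∸ single p o)
      Y'o≡ = trans (Y'≗ o) (cong (_+ _) (trans (Y≗o o) (single-self o)))

    rest≡0 : ∀ q → M q ∸ single p q ≡ 0
    rest≡0 q = +-cancelˡ-≡ (Y q) _ 0 (begin
      Y q + (M q ∸ single p q)  ≡⟨ sym (Y'≗ q) ⟩
      Y' q                      ≡⟨ Y'≗o q ⟩
      single o q                ≡⟨ sym (Y≗o q) ⟩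
      Y q                       ≡⟨ sym (+-identityʳ (Y q)) ⟩
      Y q + 0                   ∎)

module Loop {Act : Set} {np nt : ℕ} (N : PN Act (Fin np) (Fin nt))
            (i o : Fin np) (cls : Fin nt → Class) (pdo predo : Fin np)
            (wf : IsWFNet N i o) (sound : Sound N i o) (lp : LoopPattern N i o cls pdo predo) where

  open IsWFNet wf
  open LoopPattern lp

  post-i : ∀ t → post N t i ≡ false
  post-i = proj₂ (sources i) refl

  pre-o : ∀ t → pre N o t ≡ false
  pre-o = proj₂ (sinks o) refl

  pre-i-source : pre N i tsource ≡ true
  pre-i-source = proj₂ (sourcePre i) refl

  post-source-pdo : post N tsource pdo ≡ true
  post-source-pdo = proj₂ (sourcePost pdo) refl

  pre-predo-sink : pre N predo tsink ≡ true
  pre-predo-sink = proj₂ (sinkPre predo) refl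

  input : ∀ t → ∃[ q ] (pre N q t ≡ true)
  input t = has-input N (proj₁ (onPath (inj₂ t)))

  enabled-input : ∀ {M a t} → M ≗M single a → Enabled N M t → pre N a t ≡ true
  enabled-input {t = t} M≗a = Enabled-single⇒pre N M≗a (proj₂ (input t))

  classify : ∀ t → cls t ≡ cdo ⊎ cls t ≡ credo ⊎ t ≡ tsource ⊎ t ≡ tsink
  classify t with cls t in eq
  ... | cdo   = inj₁ refl
  ... | credo = inj₂ (inj₁ refl)
  ... | ctau  = inj₂ (inj₂ (proj₁ (tauBlock t) eq))

  i≢o : i ≢ o
  i≢o refl with trans (sym pre-i-source) (pre-o tsource)
  ... | ()

  pdo≢i : pdo ≢ i
  pdo≢i refl with trans (sym post-source-pdo) (post-i tsource)
  ... | ()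

  pdo≢o : pdo ≢ o
  pdo≢o refl = distinct (proj₁ (oPre tsource) post-source-pdo)

  predo≢i : predo ≢ i
  predo≢i refl = distinct (sym (proj₁ (iPost tsink) pre-predo-sink))

  predo≢o : predo ≢ o
  predo≢o refl with trans (sym pre-predo-sink) (pre-o tsink)
  ... | ()

  pdo≢predo : pdo ≢ predo
  pdo≢predo with proj₁ (doPTR _) (proj₂ doNonEmpty)
  ... | _ , W , _ = PTRWalk-head≢ N W

  source-enabled : Enabled N (single i) tsource
  source-enabled = single-input⇒Enabled N (proj₁ ∘ sourcePre)

  source-fire : fire N (single i) tsource ≗M single pdo
  source-fire = fire-single N (≢-sym pdo≢i) sourcePre sourcePost

  sink-fire : fire N (single predo) tsink ≗M single o
  sink-fire = fire-single N predo≢o sinkPre sinkPost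

  source-Lang : Lang N (single i) (single pdo) []
  source-Lang = Lang-silent N sourceSilent source-enabled source-fire

  sink-Lang : Lang N (single predo) (single o) []
  sink-Lang = Lang-silent N sinkSilent (single-input⇒Enabled N (proj₁ ∘ sinkPre)) sink-fire

  pdo-completes : ∃[ σ ] Lang N (single pdo) (single o) σ
  pdo-completes with Sound.canComplete sound _ (tsource ∷ [] , step source-enabled done)
  ... | Y , (ts , fs) , Y≗o with FireSeq-resp-≗ N (sym ∘ source-fire) fs
  ...   | Y' , fs' , Y'≗Y = _ , ts , Y' , fs' , (λ p → trans (Y'≗Y p) (Y≗o p)) , refl

  stuck-at-o : ∀ {M ts Mf} → M ≗M single o → FireSeq N M ts Mf → ts ≡ []
  stuck-at-o M≗o done = refl
  stuck-at-o M≗o (step {t = t} en _) with trans (sym (enabled-input M≗o en)) (pre-o t)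
  ... | ()

  classify-at-pdo : ∀ {M t} → M ≗M single pdo → Enabled N M t → cls t ≡ cdo
  classify-at-pdo {t = t} M≗ en with classify t
  ... | inj₁ is-do       = is-do
  ... | inj₂ (inj₁ is-redo) = contradiction (enabled-input M≗ en , is-redo) (postDoEmpty t)
  ... | inj₂ (inj₂ (inj₁ refl)) = contradiction (proj₁ (sourcePre pdo) (enabled-input M≗ en)) pdo≢i
  ... | inj₂ (inj₂ (inj₂ refl)) = contradiction (proj₁ (sinkPre pdo) (enabled-input M≗ en)) pdo≢predo

  classify-at-predo : ∀ {M t} → M ≗M single predo → Enabled N M t → t ≡ tsink ⊎ cls t ≡ credo
  classify-at-predo {t = t} M≗ en with classify t
  ... | inj₁ is-do       = contradiction (enabled-input M≗ en , is-do) (postRedoEmpty t)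
  ... | inj₂ (inj₁ is-redo) = inj₂ is-redo
  ... | inj₂ (inj₂ (inj₁ refl)) = contradiction (proj₁ (sourcePre predo) (enabled-input M≗ en)) predo≢i
  ... | inj₂ (inj₂ (inj₂ refl)) = inj₁ refl

  Touches : Fin nt → Fin np → Set
  Touches t p = pre N p t ≡ true ⊎ post N t p ≡ true

  data Phase : Class → Fin np → Fin np → Set where
    do-phase   : Phase cdo pdo predo
    redo-phase : Phase credo predo pdo

  phase-PTR : ∀ {c s e} → Phase c s e → ∀ t → (cls t ≡ c) ⇔ PTR N s e t
  phase-PTR do-phase   = doPTR
  phase-PTR redo-phase = redoPTR

  phase-classify : ∀ {c s e} → Phase c s e → ∀ t → cls t ≡ c ⊎ PTR N e s t ⊎ t ≡ tsource ⊎ t ≡ tsink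
  phase-classify do-phase t with classify t
  ... | inj₁ is-do              = inj₁ is-do
  ... | inj₂ (inj₁ is-redo)     = inj₂ (inj₁ (proj₁ (redoPTR t) is-redo))
  ... | inj₂ (inj₂ silent)      = inj₂ (inj₂ silent)
  phase-classify redo-phase t with classify t
  ... | inj₁ is-do              = inj₂ (inj₁ (proj₁ (doPTR t) is-do))
  ... | inj₂ (inj₁ is-redo)     = inj₁ is-redo
  ... | inj₂ (inj₂ silent)      = inj₂ (inj₂ silent)

  phase-class≢ctau : ∀ {c s e} → Phase c s e → c ≢ ctau
  phase-class≢ctau do-phase   ()
  phase-class≢ctau redo-phase ()

  phase-not-silent : ∀ {c s e t} → Phase c s e → cls t ≡ c → ¬ (t ≡ tsource ⊎ t ≡ tsink)
  phase-not-silent ph ec silent = phase-class≢ctau ph (trans (sym ec) (proj₂ (tauBlock _) silent))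

  phase-pre-i : ∀ {c s e t} → Phase c s e → cls t ≡ c → pre N i t ≡ false
  phase-pre-i ph ec = ¬-not (phase-not-silent ph ec ∘ inj₁ ∘ proj₁ (iPost _))

  phase-post-o : ∀ {c s e t} → Phase c s e → cls t ≡ c → post N t o ≡ false
  phase-post-o ph ec = ¬-not (phase-not-silent ph ec ∘ inj₂ ∘ proj₁ (oPre _))

  phase-post-start : ∀ {c s e t} → Phase c s e → cls t ≡ c → post N t s ≡ false
  phase-post-start do-phase   ec = ¬-not λ post≡ → preDoEmpty _ (post≡ , ec)
  phase-post-start redo-phase ec = ¬-not λ post≡ → preRedoEmpty _ (post≡ , ec)

  phase-pre-end : ∀ {c s e t} → Phase c s e → cls t ≡ c → pre N e t ≡ false
  phase-pre-end do-phase   ec = ¬-not λ pre≡ → postRedoEmpty _ (pre≡ , ec)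
  phase-pre-end redo-phase ec = ¬-not λ pre≡ → postDoEmpty _ (pre≡ , ec)

  phase-post-predo : ∀ {c s e t} → Phase c s e → cls t ≡ c → post N t predo ≡ true → e ≡ predo
  phase-post-predo do-phase   _  _     = refl
  phase-post-predo redo-phase ec post≡ = contradiction (post≡ , ec) (preRedoEmpty _)

  phase-start≢end : ∀ {c s e} → Phase c s e → s ≢ e
  phase-start≢end do-phase   = pdo≢predo
  phase-start≢end redo-phase = ≢-sym pdo≢predo

  phase-inner : ∀ {c s e p} → Phase c s e → p ≢ s → p ≢ e → p ≢ pdo × p ≢ predo
  phase-inner do-phase   p≢s p≢e = p≢s , p≢e
  phase-inner redo-phase p≢s p≢e = p≢e , p≢s

  phase-inner⁻¹ : ∀ {c s e p} → Phase c s e → p ≢ pdo → p ≢ predo → p ≢ s × p ≢ e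
  phase-inner⁻¹ do-phase   p≢pdo p≢predo = p≢pdo , p≢predo
  phase-inner⁻¹ redo-phase p≢pdo p≢predo = p≢predo , p≢pdo

  phase-reaches : ∀ {c s e} → Phase c s e → Reaches N s e
  phase-reaches do-phase with proj₁ (doPTR _) (proj₂ doNonEmpty)
  ... | _ , W , _ = inj₂ (_ , W)
  phase-reaches redo-phase with proj₁ (redoPTR _) (proj₂ redoNonEmpty)
  ... | _ , W , _ = inj₂ (_ , W)

  phase-end : ∀ {c s e M} → Phase c s e → Reachable N (single i) M → 1 ≤ M e → M ≗M single e
  phase-end do-phase   reach pos = sound⇒single N sound reach pos sink-Lang
  phase-end redo-phase reach pos = sound⇒single N sound reach pos (proj₂ pdo-completes)

  record RunFrom (p : Fin np) (ts : List (Fin nt)) : Set where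
    constructor run
    field
      {M Mf}    : Marking (Fin np)
      initial   : M ≗M single p
      reachable : Reachable N (single i) M
      firing    : FireSeq N M ts Mf
      final     : Mf ≗M single o

  RunFrom-[] : ∀ {p} → RunFrom p [] → p ≡ o
  RunFrom-[] (run M≗p _ done M≗o) = single-injective M≗p M≗o

  module PhaseRun {c s e} (ph : Phase c s e) where
    open Project N i o cls pdo predo c s e public

    i' : P'
    i' = i , inj₂ (inj₁ refl)

    o' : P'
    o' = o , inj₂ (inj₂ refl)

    -- The place of N that a place of the projection stands for: i_N stands for s and o_N for e.
    embed : P' → Fin np
    embed (p , _) with p ≟ i
    ... | yes _ = s
    ... | no _ with p ≟ o
    ...   | yes _ = e
    ...   | no _  = p

    embed-i : embed i' ≡ s
    embed-i with i ≟ i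
    ... | yes _  = refl
    ... | no i≢i = contradiction refl i≢i

    embed-o : embed o' ≡ e
    embed-o with o ≟ i
    ... | yes o≡i = contradiction (sym o≡i) i≢o
    ... | no _ with o ≟ o
    ...   | yes _  = refl
    ...   | no o≢o = contradiction refl o≢o

    embed-inner : ∀ x → proj₁ x ≢ i → proj₁ x ≢ o → embed x ≡ proj₁ x
    embed-inner (p , _) p≢i p≢o with p ≟ i
    ... | yes p≡i = contradiction p≡i p≢i
    ... | no _ with p ≟ o
    ...   | yes p≡o = contradiction p≡o p≢o
    ...   | no _    = refl

    inner-≢ : ∀ {p} → InP' p → p ≢ i → p ≢ o → p ≢ s × p ≢ e
    inner-≢ (inj₁ (_ , p≢pdo , p≢predo)) _   _   = phase-inner⁻¹ ph p≢pdo p≢predo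
    inner-≢ (inj₂ (inj₁ p≡i))           p≢i _   = contradiction p≡i p≢i
    inner-≢ (inj₂ (inj₂ p≡o))           _   p≢o = contradiction p≡o p≢o

    single-i-embed : ∀ x → single i (proj₁ x) ≡ single s (embed x)
    single-i-embed (p , w) with p ≟ i
    ... | yes refl = sym (single-self s)
    ... | no p≢i with p ≟ o
    ...   | yes refl = sym (single-other (≢-sym (phase-start≢end ph)))
    ...   | no p≢o   = sym (single-other (proj₁ (inner-≢ w p≢i p≢o)))

    single-o-embed : ∀ x → single o (proj₁ x) ≡ single e (embed x)
    single-o-embed (p , w) with p ≟ i
    ... | yes refl = trans (single-other i≢o) (sym (single-other (phase-start≢end ph)))
    ... | no p≢i with p ≟ o
    ...   | yes refl = sym (single-self e)
    ...   | no p≢o   = sym (single-other (proj₂ (inner-≢ w p≢i p≢o)))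

    pre-embed : ∀ x (t : T') → pre net x t ≡ pre N (embed x) (proj₁ t)
    pre-embed (p , _) (t , ec) with p ≟ i
    ... | yes refl rewrite phase-pre-i ph ec = refl
    ... | no _ with p ≟ o
    ...   | yes refl rewrite pre-o t | phase-pre-end ph ec = refl
    ...   | no _ = ∨-identityʳ _

    post-embed : ∀ x (t : T') → post net t x ≡ post N (proj₁ t) (embed x)
    post-embed (p , _) (t , ec) with p ≟ i
    ... | yes refl with i ≟ o
    ...   | yes i≡o = contradiction i≡o i≢o
    ...   | no _ rewrite post-i t | phase-post-start ph ec = refl
    post-embed (p , _) (t , ec) | no _ with p ≟ o
    ...   | yes refl rewrite phase-post-o ph ec = refl
    ...   | no _ = ∨-identityʳ _

    untouched-i : ∀ {t} → cls t ≡ c → ¬ Touches t i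
    untouched-i ec (inj₁ pre≡) = contradiction (trans (sym pre≡) (phase-pre-i ph ec)) λ ()
    untouched-i {t} _ (inj₂ post≡) = contradiction (trans (sym post≡) (post-i t)) λ ()

    untouched-o : ∀ {t} → cls t ≡ c → ¬ Touches t o
    untouched-o {t} _ (inj₁ pre≡) = contradiction (trans (sym pre≡) (pre-o t)) λ ()
    untouched-o ec (inj₂ post≡) = contradiction (trans (sym post≡) (phase-post-o ph ec)) λ ()

    embed-preimage : ∀ {t p} → cls t ≡ c → Touches t p → ∃[ x ] (embed x ≡ p)
    embed-preimage {t} {p} ec touch with p ≟ s | p ≟ e
    ... | yes refl | _        = i' , embed-i
    ... | no _     | yes refl = o' , embed-o
    ... | no p≢s   | no p≢e   =
      x , embed-inner x (λ p≡i → untouched-i ec (subst (Touches t) p≡i touch))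
                        (λ p≡o → untouched-o ec (subst (Touches t) p≡o touch))
      where
      x : P'
      x = p , inj₁ ((t , ec , touch) , phase-inner ph p≢s p≢e)

    record Tracks (M' : Marking P') (M : Marking (Fin np)) : Set where
      constructor tracking
      field tracked : M' ≗M (M ∘ embed)
    open Tracks

    Tracks-fire : ∀ {M' M} t → Tracks M' M → Tracks (fire net M' t) (fire N M (proj₁ t))
    Tracks-fire {M'} {M} t (tracking M'≗) = tracking fire-embed
      where
      fire-embed : ∀ x → fire net M' t x ≡ fire N M (proj₁ t) (embed x)
      fire-embed x rewrite pre-embed x t | post-embed x t | M'≗ x = refl

    Tracks-start : ∀ {M} → M ≗M single s → Tracks (single i ∘ proj₁) M
    Tracks-start M≗s = tracking λ x → trans (single-i-embed x) (sym (M≗s (embed x)))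

    Tracks-end : ∀ {M' M} → Tracks M' M → M ≗M single e → M' ≗M (single o ∘ proj₁)
    Tracks-end (tracking M'≗) M≗e x = trans (M'≗ x) (trans (M≗e (embed x)) (sym (single-o-embed x)))

    Enabled-to-N : ∀ {M' M} t → Tracks M' M → Enabled net M' t → Enabled N M (proj₁ t)
    Enabled-to-N t (tracking M'≗) en p pre≡ with embed-preimage (proj₂ t) (inj₁ pre≡)
    ... | x , refl = subst (1 ≤_) (M'≗ x) (en x (trans (pre-embed x t) pre≡))

    Enabled-to-net : ∀ {M' M} t → Tracks M' M → Enabled N M (proj₁ t) → Enabled net M' t
    Enabled-to-net t (tracking M'≗) en x pre≡ =
      subst (1 ≤_) (sym (M'≗ x)) (en (embed x) (trans (sym (pre-embed x t)) pre≡))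

    start≉end : ¬ ((single i ∘ proj₁) ≗M (single o ∘ proj₁))
    start≉end start≗end =
      i≢o (single-pos (subst (1 ≤_) (start≗end i') (≤-reflexive (sym (single-self i)))))

    -- Only valid after the first step of the phase. The weaker invariant "at s or produced by the
    -- phase" would not exclude t_sink during the redo phase, where s = p_redo.
    Produced : Marking (Fin np) → Set
    Produced M = ∀ p → 1 ≤ M p → ∃[ d ] (cls d ≡ c × post N d p ≡ true)

    Produced-fire : ∀ {M t} → Produced M → cls t ≡ c → Produced (fire N M t)
    Produced-fire {M} {t} prod ec p pos with fire-pos N {M} {t} p pos
    ... | inj₁ post≡ = t , ec , post≡
    ... | inj₂ M-pos = prod p M-pos

    Produced-start : ∀ {M t} → M ≗M single s → Enabled N M t → cls t ≡ c → Produced (fire N M t)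
    Produced-start {M} {t} M≗s en ec p pos with fire-pos N {M} {t} p pos
    ... | inj₁ post≡ = t , ec , post≡
    ... | inj₂ M-pos with single-pos (subst (1 ≤_) (M≗s p) M-pos)
    ...   | refl = contradiction (subst (1 ≤_) emptied pos) λ ()
      where
      emptied : fire N M t s ≡ 0
      emptied rewrite M≗s s | single-self s | enabled-input M≗s en | phase-post-start ph ec = refl

    Produced-image : ∀ {M q} → Produced M → 1 ≤ M q → ∃[ x ] (embed x ≡ q)
    Produced-image prod pos with prod _ pos
    ... | _ , dc , post≡ = embed-preimage dc (inj₂ post≡)

    Produced-end : ∀ {M' M} → Tracks M' M → M' ≗M (single o ∘ proj₁) → Produced M → M ≗M single e
    Produced-end {M'} {M} (tracking M'≗) M'≗o prod p with 1 ≤? M p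
    ... | yes pos = on-image (Produced-image prod pos)
      where
      on-image : ∀ {q} → ∃[ x ] (embed x ≡ q) → M q ≡ single e q
      on-image (x , refl) = trans (sym (M'≗ x)) (trans (M'≗o x) (single-o-embed x))
    ... | no ¬pos = trans (n<1⇒n≡0 (≰⇒> ¬pos)) (sym (single-other p≢e))
      where
      e-marked : 1 ≤ M e
      e-marked = subst (λ q → 1 ≤ M q) embed-o
                   (≤-reflexive (sym (trans (sym (M'≗ o')) (trans (M'≗o o') (single-self o)))))

      p≢e : p ≢ e
      p≢e p≡e = ¬pos (subst (λ q → 1 ≤ M q) (sym p≡e) e-marked)

    simulate : ∀ {M' us Mf'} → FireSeq net M' us Mf' → ∀ {M} → Tracks M' M → Produced M →
               ∃[ Mf ] (FireSeq N M (map proj₁ us) Mf × Tracks Mf' Mf × Produced Mf)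
    simulate done tr prod = _ , done , tr , prod
    simulate (step {t = t} en fs) tr prod with simulate fs (Tracks-fire t tr) (Produced-fire prod (proj₂ t))
    ... | Mf , fs' , tr' , prod' = Mf , step (Enabled-to-N t tr en) fs' , tr' , prod'

    Tracks-initial : Tracks (single i ∘ proj₁) (single s)
    Tracks-initial = Tracks-start λ _ → refl

    projection⇒N : ∀ {σ} → LangProj σ → Lang N (single s) (single e) σ
    projection⇒N ([] , _ , done , final , _) = contradiction final start≉end
    projection⇒N ((t , ec) ∷ us , _ , step en fs , final , refl)
      with simulate fs (Tracks-fire (t , ec) Tracks-initial)
                       (Produced-start (λ _ → refl) (Enabled-to-N (t , ec) Tracks-initial en) ec)
    ... | Mf , fs' , tr , prod =
      t ∷ map proj₁ us , Mf , step (Enabled-to-N (t , ec) Tracks-initial en) fs' ,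
      Produced-end tr final prod , mapMaybe-map (label N) proj₁ ((t , ec) ∷ us)

    -- The consumed token was produced on a walk from s avoiding e, and the outputs of t reach s,
    -- hence e; so t also lies on such a walk from s to e.
    PTR-back⇒PTR : ∀ {M t} → ¬ 1 ≤ M e → Produced M → Enabled N M t → PTR N e s t → PTR N s e t
    PTR-back⇒PTR {M} {t} e-unmarked prod en t∈PTR with input t
    ... | q , pre-q with prod q (en q pre-q)
    ...   | d , dc , post-dq with PTR-split N (proj₁ (phase-PTR ph d) dc) | PTR-split N t∈PTR
    ...     | _ , _ , w , x≢e , pre-xd , _ , _ | _ , _ , _ , _ , _ , post-ty , y↝s =
      PTR-join N (snoc w x≢e pre-xd post-dq) q≢e pre-q post-ty
                 (Reaches-trans N _≟_ y↝s (phase-reaches ph))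
      where
      q≢e : q ≢ e
      q≢e q≡e = e-unmarked (subst (λ p → 1 ≤ M p) q≡e (en q pre-q))

    enabled-in-phase : ∀ {M t} → ¬ 1 ≤ M e → Produced M → Enabled N M t → cls t ≡ c
    enabled-in-phase {M} {t} e-unmarked prod en with phase-classify ph t
    ... | inj₁ ec = ec
    ... | inj₂ (inj₁ t∈PTR) = proj₂ (phase-PTR ph t) (PTR-back⇒PTR e-unmarked prod en t∈PTR)
    ... | inj₂ (inj₂ (inj₁ refl)) with prod i (en i pre-i-source)
    ...   | d , _ , post≡ = contradiction (trans (sym post≡) (post-i d)) λ ()
    enabled-in-phase {M} {t} e-unmarked prod en | inj₂ (inj₂ (inj₂ refl))
      with prod predo (en predo pre-predo-sink)
    ...   | _ , dc , post≡ =
      contradiction (subst (λ p → 1 ≤ M p) (sym (phase-post-predo ph dc post≡)) (en predo pre-predo-sink))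
                    e-unmarked

    record Split (M' : Marking P') (ts : List (Fin nt)) : Set where
      constructor split
      field
        {us}      : List T'
        {vs}      : List (Fin nt)
        {M''}     : Marking P'
        projected : FireSeq net M' us M''
        completed : M'' ≗M (single o ∘ proj₁)
        rest      : RunFrom e vs
        consumed  : ts ≡ map proj₁ us ++ vs

    Split-∷ : ∀ {M' ts} t → Enabled net M' t → Split (fire net M' t) ts → Split M' (proj₁ t ∷ ts)
    Split-∷ t en (split fs completed rest refl) = split (step {t = t} en fs) completed rest refl

    Split-word : ∀ {ts} (sp : Split (single i ∘ proj₁) ts) → LangProj (visible net (Split.us sp))
    Split-word sp = _ , _ , Split.projected sp , Split.completed sp , refl

    Split-visible : ∀ {M' ts} (sp : Split M' ts) →
                    visible N ts ≡ visible net (Split.us sp) ++ visible N (Split.vs sp)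
    Split-visible (split {us} {vs} _ _ _ refl) =
      trans (visible-++ N (map proj₁ us) vs) (cong (_++ visible N vs) (mapMaybe-map (label N) proj₁ us))

    Split-shorter : ∀ {ts} (sp : Split (single i ∘ proj₁) ts) → length (Split.vs sp) < length ts
    Split-shorter (split {[]} done completed _ _)   = contradiction completed start≉end
    Split-shorter (split {_ ∷ us} {vs} _ _ _ refl) = s≤s (length-++-≤ʳ vs {map proj₁ us})

    -- The phase ends as soon as e is marked; soundness then forces the marking [e].
    split-at-end : ∀ {M M' ts Mf} → Tracks M' M → Produced M → Reachable N (single i) M →
                   FireSeq N M ts Mf → Mf ≗M single o → Split M' ts
    split-at-end {M} tr prod reach fs final with 1 ≤? M e
    ... | yes e-marked = split done (Tracks-end tr M≗e) (run M≗e reach fs final) refl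
      where
      M≗e : M ≗M single e
      M≗e = phase-end ph reach e-marked
    ... | no e-unmarked with fs
    ...   | done with prod o (subst (1 ≤_) (sym (final o)) (≤-reflexive (sym (single-self o))))
    ...     | _ , dc , post≡ = contradiction (trans (sym post≡) (phase-post-o ph dc)) λ ()
    split-at-end {M} tr prod reach fs final | no e-unmarked | step {t = t} en fs' =
      Split-∷ (t , ec) (Enabled-to-net (t , ec) tr en)
        (split-at-end (Tracks-fire (t , ec) tr) (Produced-fire prod ec)
                      (Reachable-++ N reach (step en done)) fs' final)
      where
      ec : cls t ≡ c
      ec = enabled-in-phase e-unmarked prod en

    phase-split : ∀ {t ts} → RunFrom s (t ∷ ts) → cls t ≡ c → Split (single i ∘ proj₁) (t ∷ ts)
    phase-split (run M≗s reach (step en fs) final) ec =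
      Split-∷ (_ , ec) (Enabled-to-net (_ , ec) (Tracks-start M≗s) en)
        (split-at-end (Tracks-fire (_ , ec) (Tracks-start M≗s)) (Produced-start M≗s en ec)
                      (Reachable-++ N reach (step en done)) fs final)

  module D = PhaseRun do-phase
  module R = PhaseRun redo-phase

  Ldo : List Act → Set
  Ldo = LangLoopProjectDo N i o cls pdo predo

  Lredo : List Act → Set
  Lredo = LangLoopProjectRedo N i o cls pdo predo

  loop⇒pdo-predo : ∀ {σ} → LoopL Ldo Lredo σ → Lang N (single pdo) (single predo) σ
  loop⇒pdo-predo (once w) = D.projection⇒N w
  loop⇒pdo-predo (again {σ} {τ} {ρ} l w w') =
    subst (Lang N (single pdo) (single predo)) (++-assoc σ τ ρ)
      (Lang-++ N (Lang-++ N (loop⇒pdo-predo l) (R.projection⇒N w)) (D.projection⇒N w'))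

  loop⇒N : ∀ {σ} → LoopL Ldo Lredo σ → LangWF N i o σ
  loop⇒N {σ} l = subst (LangWF N i o) (++-identityʳ σ)
                   (Lang-++ N source-Lang (Lang-++ N (loop⇒pdo-predo l) sink-Lang))

  do-split : ∀ {ts} → RunFrom pdo ts → D.Split (single i ∘ proj₁) ts
  do-split r@(run _  _ done _)       = contradiction (RunFrom-[] r) pdo≢o
  do-split r@(run M≗ _ (step en _) _) = D.phase-split r (classify-at-pdo M≗ en)

  from-predo : ∀ {σ ts} → Acc _<_ (length ts) → LoopL Ldo Lredo σ → RunFrom predo ts →
               LoopL Ldo Lredo (σ ++ visible N ts)
  from-predo _ _ r@(run _ _ done _) = contradiction (RunFrom-[] r) predo≢o
  from-predo {σ} (acc rs) l r@(run M≗ reach (step en fs) final) with classify-at-predo M≗ en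
  ... | inj₁ refl with stuck-at-o (λ p → trans (fire-resp-≗ N tsink M≗ p) (sink-fire p)) fs
  ...   | refl = subst (LoopL Ldo Lredo) σ≡ l
    where
    σ≡ : σ ≡ σ ++ visible N (tsink ∷ [])
    σ≡ = sym (trans (cong (σ ++_) (visible-silent N [] sinkSilent)) (++-identityʳ σ))
  from-predo {σ} {t ∷ ts} (acc rs) l r | inj₂ is-redo =
    subst (LoopL Ldo Lredo) rearrange
      (from-predo (rs (<-trans (D.Split-shorter sD) (R.Split-shorter sR)))
                  (again l (R.Split-word sR) (D.Split-word sD)) (D.Split.rest sD))
    where
    sR : R.Split (single i ∘ proj₁) (t ∷ ts)
    sR = R.phase-split r is-redo

    sD : D.Split (single i ∘ proj₁) (R.Split.vs sR)
    sD = do-split (R.Split.rest sR)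

    τ ρ : List Act
    τ = visible R.net (R.Split.us sR)
    ρ = visible D.net (D.Split.us sD)

    rearrange : (σ ++ τ ++ ρ) ++ visible N (D.Split.vs sD) ≡ σ ++ visible N (t ∷ ts)
    rearrange = begin
      (σ ++ τ ++ ρ) ++ visible N (D.Split.vs sD)  ≡⟨ ++-assoc σ (τ ++ ρ) _ ⟩
      σ ++ (τ ++ ρ) ++ visible N (D.Split.vs sD)  ≡⟨ cong (σ ++_) (++-assoc τ ρ _) ⟩
      σ ++ τ ++ ρ ++ visible N (D.Split.vs sD)    ≡⟨ cong (λ w → σ ++ τ ++ w) (sym (D.Split-visible sD)) ⟩
      σ ++ τ ++ visible N (R.Split.vs sR)         ≡⟨ cong (σ ++_) (sym (R.Split-visible sR)) ⟩
      σ ++ visible N (t ∷ ts)                     ∎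
      where open ≡-Reasoning

  N⇒loop : ∀ {σ} → LangWF N i o σ → LoopL Ldo Lredo σ
  N⇒loop (_ , _ , done , final , _) = contradiction (single-injective (λ _ → refl) final) i≢o
  N⇒loop (t ∷ ts , _ , step en fs , final , refl) with proj₁ (iPost t) (enabled-input (λ _ → refl) en)
  ... | refl = subst (LoopL Ldo Lredo) (sym (trans (visible-silent N ts sourceSilent) (D.Split-visible sD)))
                 (from-predo (<-wellFounded _) (once (D.Split-word sD)) (D.Split.rest sD))
    where
    sD : D.Split (single i ∘ proj₁) ts
    sD = do-split (run source-fire (_ , step en done) fs final)

  loop-language : LoopL Ldo Lredo ≐ LangWF N i o
  loop-language σ = loop⇒N , N⇒loop

LoopL-map : ∀ {A : Set} {L₁ L₂ K₁ K₂ : List A → Set} →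
            (∀ {σ} → L₁ σ → K₁ σ) → (∀ {σ} → L₂ σ → K₂ σ) → ∀ {σ} → LoopL L₁ L₂ σ → LoopL K₁ K₂ σ
LoopL-map f g (once w)        = once (f w)
LoopL-map f g (again l w w') = again (LoopL-map f g l) (g w) (f w')

lemma5 : {Act : Set} {np nt : ℕ} (N : PN Act (Fin np) (Fin nt))
         (i o : Fin np) (cls : Fin nt → Class) (pdo predo : Fin np) →
         IsWFNet N i o → Safe N i → Sound N i o →
         LoopPattern N i o cls pdo predo →
         (φdo φredo : POWL Act) →
         LangLoopProjectDo N i o cls pdo predo ≐ LangP φdo →
         LangLoopProjectRedo N i o cls pdo predo ≐ LangP φredo →
         LangP (loop φdo φredo) ≐ LangWF N i o
lemma5 N i o cls pdo predo wf _ sound lp φdo φredo hdo hredo σ =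
    (λ l → proj₁ (loop-language σ) (LoopL-map (proj₂ (hdo _)) (proj₂ (hredo _)) l))
  , (λ w → LoopL-map (proj₁ (hdo _)) (proj₁ (hredo _)) (proj₂ (loop-language σ) w))
  where open Loop N i o cls pdo predo wf sound lp
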